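{- Let $D$ be a digraph with an edge-magic (respectively super edge-magic) labeling $f$, and let $\overline f$ be its complementary labeling. Let $p$ be an odd positive integer, $k=(p+3)/2$, and $h:E(D)\to\mathcal{S}_p^{k}$ any function. Let $\hat f$ be the labeling of $D\otimes_h\mathcal{S}_p^{k}$ induced by $f$ and $\overline{\hat f}$ its complementary labeling. Then there exists $\bar h:E(D)\to \mathcal{S}_p^{k}$ such that the labeling $\hat{\overline f}$ of $D\otimes_{\bar h}\mathcal{S}_p^{k}$ induced by $\overline f$ satisfies $\mathrm{val}(\overline{\hat f})=\mathrm{val}(\hat{\overline f})$.
   Context: Graphs and digraphs may have loops but no multiple arcs. $[a,b]=\{a,\dots,b\}$. An edge-magic labeling of a $(p,q)$-(di)graph $G$ is a bijection $f:V(G)\cup E(G)\to[1,p+q]$ with $f(x)+f(xy)+f(y)=\mathrm{val}(f)$ constant over edges; super if $f(V(G))=[1,p]$. Complementary labeling: $\overline f(x)=p+q+1-f(x)$. $\mathcal{S}_p^k$: the set of digraphs $F$ with vertex set $[1,p]$, exactly $p$ arcs, and $\{i+j:(i,j)\in E(F)\}=[k,k+p-1]$. For $h$ from $E(D)$ to a family of digraphs with common vertex set $V$, $D\otimes_h\Gamma$ has vertex set $V(D)\times V$ and arcs $((a,i),(b,j))$ with $(a,b)\in E(D)$, $(i,j)\in E(h(a,b))$. For an edge-magic labeling $g$ of $D$ and $h:E(D)\to\mathcal{S}_p^k$, the induced labeling $\hat g$ of $D\otimes_h\mathcal{S}_p^k$ is $\hat g(a,i)=p(g(a)-1)+i$,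 $\hat g((a,i),(b,j))=p(g((a,b))-1)+k+p-(i+j)$; it is edge-magic. -}

module Defs where

open import Level using (0ℓ)
open import Data.Nat using (ℕ; _+_; _*_; _∸_; _≤_)
open import Data.Fin using (Fin; toℕ)
open import Data.Fin.Properties using (*↔×)
open import Data.Product using (Σ; ∃; _×_; _,_; proj₁; proj₂)
open import Data.Sum using (_⊎_; inj₁; inj₂)
open import Function using (Injective)
open import Function.Bundles using (_↔_)
open import Function.Properties.Inverse using (↔-refl; ↔-sym; ↔-trans)
open import Data.Product.Function.NonDependent.Propositional using (_×-↔_)
open import Relation.Binary.PropositionalEquality using (_≡_)

record Digraph : Set₁ where
  field
    V E   : Set
    src tgt : E → V
    nV nE : ℕ
    V-fin : V ↔ Fin nV
    E-fin : E ↔ Fin nE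
open Digraph public

NoMultipleArcs : Digraph → Set
NoMultipleArcs D = ∀ (e e′ : E D) → src D e ≡ src D e′ → tgt D e ≡ tgt D e′ → e ≡ e′

Labeling : Digraph → Set
Labeling D = V D ⊎ E D → ℕ

IsBijectionOnto : (A : Set) → (A → ℕ) → ℕ → Set
IsBijectionOnto A f N =
  (∀ x → 1 ≤ f x × f x ≤ N) × Injective _≡_ _≡_ f × (∀ n → 1 ≤ n → n ≤ N → ∃ λ x → f x ≡ n)

IsEdgeMagicWithVal : (D : Digraph) → Labeling D → ℕ → Set
IsEdgeMagicWithVal D f c =
  IsBijectionOnto (V D ⊎ E D) f (nV D + nE D) ×
  (∀ (e : E D) → f (inj₁ (src D e)) + f (inj₂ e) + f (inj₁ (tgt D e)) ≡ c)

IsEdgeMagic : (D : Digraph) → Labeling D → Set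
IsEdgeMagic D f = ∃ λ c → IsEdgeMagicWithVal D f c

complement : (D : Digraph) → Labeling D → Labeling D
complement D f x = nV D + nE D + 1 ∸ f x

-- Vertex i ∈ [1,p] is represented by (a : Fin p) with i = toℕ a + 1.
vlab : {p : ℕ} → Fin p → ℕ
vlab a = toℕ a + 1

-- An element of S_p^k: a digraph on [1,p] with exactly p arcs
-- (arc r, r ∈ Fin p, listed injectively, i.e. no repeated arc)
-- whose set of arc sums {i + j} is exactly [k, k+p-1].
record S (p k : ℕ) : Set where
  field
    arc     : Fin p → Fin p × Fin p
    arc-inj : Injective _≡_ _≡_ arc
    sum-in  : ∀ r → k ≤ vlab (proj₁ (arc r)) + vlab (proj₂ (arc r))
                  × vlab (proj₁ (arc r)) + vlab (proj₂ (arc r)) ≤ k + p ∸ 1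
    sum-onto : ∀ n → k ≤ n → n ≤ k + p ∸ 1 →
               ∃ λ r → vlab (proj₁ (arc r)) + vlab (proj₂ (arc r)) ≡ n
open S public

-- the ⊗_h product  D ⊗_h S_p^k : vertices V(D) × [1,p],
-- arcs ((a,i),(b,j)) for e = (a,b) ∈ E(D) and (i,j) ∈ E(h e)
⊗-prod : (D : Digraph) (p k : ℕ) → (E D → S p k) → Digraph
⊗-prod D p k h = record
  { V = V D × Fin p
  ; E = E D × Fin p
  ; src = λ { (e , r) → src D e , proj₁ (arc (h e) r) }
  ; tgt = λ { (e , r) → tgt D e , proj₂ (arc (h e) r) }
  ; nV = nV D * p
  ; nE = nE D * p
  ; V-fin = ↔-trans (V-fin D ×-↔ ↔-refl) (↔-sym *↔×)
  ; E-fin = ↔-trans (E-fin D ×-↔ ↔-refl) (↔-sym *↔×)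
  }

-- the induced labeling ĝ of D ⊗_h S_p^k:
--   ĝ(a,i) = p(g(a)−1) + i,   ĝ((a,i),(b,j)) = p(g((a,b))−1) + k + p − (i+j)
induced : (D : Digraph) (p k : ℕ) (h : E D → S p k) → Labeling D → Labeling (⊗-prod D p k h)
induced D p k h g (inj₁ (a , i)) = p * (g (inj₁ a) ∸ 1) + vlab i
induced D p k h g (inj₂ (e , r)) =
  p * (g (inj₂ e) ∸ 1) + (k + p ∸ (vlab (proj₁ (arc (h e) r)) + vlab (proj₂ (arc (h e) r))))

module Submission where

-- The induced labeling writes the elements of D ⊗_h S_p^k in base p: the copies of a vertex or arc
-- of D get the digits [1, p], for arcs because their arc sums i + j run through [k, k + p − 1].
-- Hence it is a bijection onto [1, p (|V| + |E|)], edge-magic of valence p (c − 3) + k + p when g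
-- has valence c, while complementation sends a valence c to 3 (|V| + |E| + 1) − c. When 2k = p + 3
-- the two valences in the statement coincide for every choice of h and h̄, so h̄ = h works.

open import Defs
open import Data.Nat using (ℕ; zero; suc; _+_; _*_; _∸_; _≤_; _<_; _%_; _/_; NonZero; z≤n; s≤s)
open import Data.Nat.Properties
open import Data.Nat.DivMod using (m≡m%n+[m/n]*n; m%n<n; m<n*o⇒m/o<n; m*n/n≡m)
open import Data.Nat.Tactic.RingSolver using (solve-∀)
open import Data.Fin using (Fin; toℕ; fromℕ<; punchIn; punchOut)
open import Data.Fin.Properties using (toℕ<n; toℕ-injective; toℕ-fromℕ<; injective⇒≤; punchIn-punchOut)
  renaming (_≟_ to _≟ᶠ_)
open import Data.Product using (Σ; ∃; ∃₂; _×_; _,_; proj₁; proj₂; uncurry)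
open import Data.Sum using (_⊎_; inj₁; inj₂)
open import Function using (_∘_; Injective)
open import Relation.Nullary using (yes; no; contradiction)
open import Relation.Binary.Definitions using (tri<; tri≈; tri>)
open import Relation.Binary.PropositionalEquality

+-∸-interchange : ∀ {m n o q} → n ≤ m → q ≤ o → (m ∸ n) + (o ∸ q) ≡ (m + o) ∸ (n + q)
+-∸-interchange {m} {n} {o} {q} n≤m q≤o = begin
  (m ∸ n) + (o ∸ q)  ≡⟨ +-∸-assoc (m ∸ n) q≤o ⟨
  (m ∸ n) + o ∸ q    ≡⟨ cong (_∸ q) (+-∸-comm o n≤m) ⟨
  (m + o) ∸ n ∸ q    ≡⟨ ∸-+-assoc (m + o) n q ⟩
  (m + o) ∸ (n + q)  ∎
  where open ≡-Reasoning

+-∸-interchange₃ : ∀ {x y z a b c} → a ≤ x → b ≤ y → c ≤ z →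
                   (x ∸ a) + (y ∸ b) + (z ∸ c) ≡ (x + y + z) ∸ (a + b + c)
+-∸-interchange₃ {z = z} {c = c} a≤x b≤y c≤z =
  trans (cong (_+ (z ∸ c)) (+-∸-interchange a≤x b≤y)) (+-∸-interchange (+-mono-≤ a≤x b≤y) c≤z)

pred-sum₃ : ∀ {x y z} → 1 ≤ x → 1 ≤ y → 1 ≤ z → (x ∸ 1) + (y ∸ 1) + (z ∸ 1) ≡ x + y + z ∸ 3
pred-sum₃ = +-∸-interchange₃

radix-≤ : ∀ {p q r} → 1 ≤ q → r ≤ p → p * (q ∸ 1) + r ≤ p * q
radix-≤ {p} {suc q} {r} _ r≤p = begin
  p * q + r  ≤⟨ +-monoʳ-≤ (p * q) r≤p ⟩
  p * q + p  ≡⟨ +-comm (p * q) p ⟩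
  p + p * q  ≡⟨ *-suc p q ⟨
  p * suc q  ∎
  where open ≤-Reasoning

radix-< : ∀ {p q q′ r r′} → q < q′ → r ≤ p → 1 ≤ r′ → p * q + r < p * q′ + r′
radix-< {p} {q} {q′} {r} {r′} q<q′ r≤p 1≤r′ = begin-strict
  p * q + r          ≤⟨ radix-≤ (s≤s z≤n) r≤p ⟩
  p * suc q          ≤⟨ *-monoʳ-≤ p q<q′ ⟩
  p * q′             <⟨ m<m+n (p * q′) 1≤r′ ⟩
  p * q′ + r′        ∎
  where open ≤-Reasoning

radix-quotient-unique : ∀ {p q q′ r r′} → 1 ≤ r → r ≤ p → 1 ≤ r′ → r′ ≤ p →
                        p * q + r ≡ p * q′ + r′ → q ≡ q′
radix-quotient-unique {q = q} {q′} 1≤r r≤p 1≤r′ r′≤p eq with <-cmp q q′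
... | tri< q<q′ _ _ = contradiction eq (<⇒≢ (radix-< q<q′ r≤p 1≤r′))
... | tri≈ _ q≡q′ _ = q≡q′
... | tri> _ _ q′<q = contradiction (sym eq) (<⇒≢ (radix-< q′<q r′≤p 1≤r))

radix-decompose : ∀ {p N n} .{{_ : NonZero p}} → 1 ≤ n → n ≤ p * N →
                  ∃₂ λ q r → q < N × (1 ≤ r × r ≤ p) × p * q + r ≡ n
radix-decompose {p} {N} {suc m} _ n≤pN =
  m / p , suc (m % p) , m<n*o⇒m/o<n m<Np , (s≤s z≤n , m%n<n m p) , m-decomposed
  where
  m<Np : m < N * p
  m<Np = subst (m <_) (*-comm p N) n≤pN
  m-decomposed : p * (m / p) + suc (m % p) ≡ suc m
  m-decomposed = begin
    p * (m / p) + suc (m % p)  ≡⟨ +-suc (p * (m / p)) (m % p) ⟩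
    suc (p * (m / p) + m % p)  ≡⟨ cong suc (+-comm (p * (m / p)) (m % p)) ⟩
    suc (m % p + p * (m / p))  ≡⟨ cong (λ t → suc (m % p + t)) (*-comm p (m / p)) ⟩
    suc (m % p + m / p * p)    ≡⟨ cong suc (m≡m%n+[m/n]*n m p) ⟨
    suc m                      ∎
    where open ≡-Reasoning

reflect-in-range : ∀ {N n} → 1 ≤ n → n ≤ N → 1 ≤ N + 1 ∸ n × N + 1 ∸ n ≤ N
reflect-in-range {N} {n} 1≤n n≤N =
  m<n⇒0<n∸m (subst (n <_) (+-comm 1 N) (s≤s n≤N)) ,
  ≤-trans (∸-monoʳ-≤ (N + 1) 1≤n) (≤-reflexive (m+n∸n≡m N 1))

IsBijectionOnto-reflect : ∀ {A : Set} {g : A → ℕ} {N} →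
                          IsBijectionOnto A g N → IsBijectionOnto A (λ x → N + 1 ∸ g x) N
IsBijectionOnto-reflect {g = g} {N} (g-in-range , g-injective , g-onto) =
  in-range , injective , onto
  where
  ≤N+1 : ∀ {n} → n ≤ N → n ≤ N + 1
  ≤N+1 {n} n≤N = ≤-trans n≤N (m≤m+n N 1)
  in-range : ∀ x → 1 ≤ N + 1 ∸ g x × N + 1 ∸ g x ≤ N
  in-range x = reflect-in-range (proj₁ (g-in-range x)) (proj₂ (g-in-range x))
  injective : Injective _≡_ _≡_ (λ x → N + 1 ∸ g x)
  injective {x} {y} eq =
    g-injective (∸-cancelˡ-≡ (≤N+1 (proj₂ (g-in-range x))) (≤N+1 (proj₂ (g-in-range y))) eq)
  onto : ∀ n → 1 ≤ n → n ≤ N → ∃ λ x → N + 1 ∸ g x ≡ n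
  onto n 1≤n n≤N with x , gx≡ ← g-onto (N + 1 ∸ n) (proj₁ (reflect-in-range 1≤n n≤N))
                                                 (proj₂ (reflect-in-range 1≤n n≤N))
    = x , trans (cong (N + 1 ∸_) gx≡) (m∸[m∸n]≡n (≤N+1 n≤N))

record FibreNumbering {X Y : Set} (π : X → Y) (ρ : X → ℕ) (p : ℕ) : Set where
  field
    in-range  : ∀ x → 1 ≤ ρ x × ρ x ≤ p
    injective : ∀ {x x′} → π x ≡ π x′ → ρ x ≡ ρ x′ → x ≡ x′
    onto      : ∀ y j → 1 ≤ j → j ≤ p → ∃ λ x → π x ≡ y × ρ x ≡ j

IsBijectionOnto-blowUp : ∀ {X Y : Set} {π : X → Y} {ρ : X → ℕ} {p N} .{{_ : NonZero p}}
  {g : Y → ℕ} {L : X → ℕ} → FibreNumbering π ρ p → IsBijectionOnto Y g N →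
  (∀ x → L x ≡ p * (g (π x) ∸ 1) + ρ x) → IsBijectionOnto X L (p * N)
IsBijectionOnto-blowUp {π = π} {ρ} {p} {N} {g = g} {L} fibres (g-in-range , g-injective , g-onto) L≡ =
  in-range , injective , onto
  where
  module F = FibreNumbering fibres
  1≤g : ∀ x → 1 ≤ g (π x)
  1≤g x = proj₁ (g-in-range (π x))
  in-range : ∀ x → 1 ≤ L x × L x ≤ p * N
  in-range x rewrite L≡ x =
    ≤-trans (proj₁ (F.in-range x)) (m≤n+m (ρ x) _) ,
    ≤-trans (radix-≤ (1≤g x) (proj₂ (F.in-range x))) (*-monoʳ-≤ p (proj₂ (g-in-range (π x))))
  injective : Injective _≡_ _≡_ L
  injective {x} {y} eq = F.injective πx≡πy ρx≡ρy
    where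
    eq′ : p * (g (π x) ∸ 1) + ρ x ≡ p * (g (π y) ∸ 1) + ρ y
    eq′ = trans (sym (L≡ x)) (trans eq (L≡ y))
    gx≡gy : g (π x) ≡ g (π y)
    gx≡gy = ∸-cancelʳ-≡ (1≤g x) (1≤g y)
      (radix-quotient-unique (proj₁ (F.in-range x)) (proj₂ (F.in-range x))
                             (proj₁ (F.in-range y)) (proj₂ (F.in-range y)) eq′)
    πx≡πy : π x ≡ π y
    πx≡πy = g-injective gx≡gy
    ρx≡ρy : ρ x ≡ ρ y
    ρx≡ρy = +-cancelˡ-≡ (p * (g (π x) ∸ 1)) _ _ (trans eq′ (cong (λ t → p * (t ∸ 1) + ρ y) (sym gx≡gy)))
  onto : ∀ n → 1 ≤ n → n ≤ p * N → ∃ λ x → L x ≡ n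
  onto n 1≤n n≤pN
    with q , r , q<N , (1≤r , r≤p) , pq+r≡n ← radix-decompose 1≤n n≤pN
    with y , gy≡ ← g-onto (suc q) (s≤s z≤n) q<N
    with x , refl , refl ← F.onto y r 1≤r r≤p
    = x , trans (L≡ x) (trans (cong (λ t → p * (t ∸ 1) + ρ x) gy≡) pq+r≡n)

n+n+n≡3*n : ∀ n → n + n + n ≡ 3 * n
n+n+n≡3*n = solve-∀

complement-sum₃ : ∀ {M x y z} → x ≤ M → y ≤ M → z ≤ M →
                  (M ∸ x) + (M ∸ y) + (M ∸ z) ≡ 3 * M ∸ (x + y + z)
complement-sum₃ {M} {x} {y} {z} x≤M y≤M z≤M =
  trans (+-∸-interchange₃ x≤M y≤M z≤M) (cong (_∸ (x + y + z)) (n+n+n≡3*n M))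

complement-edgeMagic : ∀ (G : Digraph) {g : Labeling G} {c} → IsEdgeMagicWithVal G g c →
  IsEdgeMagicWithVal G (complement G g) (3 * (nV G + nE G + 1) ∸ c)
complement-edgeMagic G {g} {c} (bijective , magic) = IsBijectionOnto-reflect bijective , magic′
  where
  ≤N+1 : ∀ x → g x ≤ nV G + nE G + 1
  ≤N+1 x = ≤-trans (proj₂ (proj₁ bijective x)) (m≤m+n _ 1)
  magic′ : ∀ e → let x = complement G g in
           x (inj₁ (src G e)) + x (inj₂ e) + x (inj₁ (tgt G e)) ≡ 3 * (nV G + nE G + 1) ∸ c
  magic′ e = trans (complement-sum₃ (≤N+1 _) (≤N+1 _) (≤N+1 _)) (cong (3 * (nV G + nE G + 1) ∸_) (magic e))

edgeMagic-valence-bounds : ∀ (G : Digraph) {g : Labeling G} {c} → IsEdgeMagicWithVal G g c →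
                           E G → 3 ≤ c × c ≤ 3 * (nV G + nE G)
edgeMagic-valence-bounds G {g} ((in-range , _) , magic) e rewrite sym (magic e) =
  +-mono-≤ (+-mono-≤ (lower (inj₁ (src G e))) (lower (inj₂ e))) (lower (inj₁ (tgt G e))) ,
  ≤-trans (+-mono-≤ (+-mono-≤ (upper (inj₁ (src G e))) (upper (inj₂ e))) (upper (inj₁ (tgt G e))))
          (≤-reflexive (n+n+n≡3*n (nV G + nE G)))
  where
  lower : ∀ x → 1 ≤ g x
  lower = proj₁ ∘ in-range
  upper : ∀ x → g x ≤ nV G + nE G
  upper = proj₂ ∘ in-range

edgeMagic-cong-valence : ∀ (G : Digraph) {g : Labeling G} {c c′} → (E G → c ≡ c′) →
                         IsEdgeMagicWithVal G g c → IsEdgeMagicWithVal G g c′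
edgeMagic-cong-valence G c≡c′ (bijective , magic) = bijective , λ e → trans (magic e) (c≡c′ e)

interval-cover⇒≤ : ∀ {m n} (s : Fin n → ℕ) (k : ℕ) →
                   (∀ (t : Fin m) → ∃ λ r → s r ≡ k + toℕ t) → m ≤ n
interval-cover⇒≤ s k cover = injective⇒≤ section-injective
  where
  section-injective : Injective _≡_ _≡_ (proj₁ ∘ cover)
  section-injective {t} {t′} eq = toℕ-injective (+-cancelˡ-≡ k _ _
    (trans (sym (proj₂ (cover t))) (trans (cong s eq) (proj₂ (cover t′)))))

-- If s identified r ≠ r′, then s ∘ punchIn r would cover n + 1 numbers with n points.
interval-cover⇒injective : ∀ {n} (s : Fin n → ℕ) (k : ℕ) →
                           (∀ (t : Fin n) → ∃ λ r → s r ≡ k + toℕ t) → Injective _≡_ _≡_ s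
interval-cover⇒injective {suc n} s k cover {r} {r′} sr≡sr′ with r ≟ᶠ r′
... | yes r≡r′ = r≡r′
... | no r≢r′  = contradiction (interval-cover⇒≤ (s ∘ punchIn r) k cover′) 1+n≰n
  where
  cover′ : ∀ t → ∃ λ j → s (punchIn r j) ≡ k + toℕ t
  cover′ t with u , su≡ ← cover t with r ≟ᶠ u
  ... | yes refl = punchOut r≢r′ , trans (cong s (punchIn-punchOut r≢r′)) (trans (sym sr≡sr′) su≡)
  ... | no r≢u   = punchOut r≢u , trans (cong s (punchIn-punchOut r≢u)) su≡

arcSum : ∀ {p k} → S p k → Fin p → ℕ
arcSum σ r = vlab (proj₁ (arc σ r)) + vlab (proj₂ (arc σ r))

module _ {n k : ℕ} (σ : S (suc n) k) where

  private
    k+n≡ : k + suc n ∸ 1 ≡ k + n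
    k+n≡ = cong (_∸ 1) (+-suc k n)

  arcSum-bounds : ∀ r → k ≤ arcSum σ r × arcSum σ r < k + suc n
  arcSum-bounds r = proj₁ (sum-in σ r) ,
    subst (arcSum σ r <_) (sym (+-suc k n)) (s≤s (subst (arcSum σ r ≤_) k+n≡ (proj₂ (sum-in σ r))))

  arcSum-injective : Injective _≡_ _≡_ (arcSum σ)
  arcSum-injective = interval-cover⇒injective (arcSum σ) k λ t →
    sum-onto σ (k + toℕ t) (m≤m+n k (toℕ t))
      (subst (k + toℕ t ≤_) (sym k+n≡) (+-monoʳ-≤ k (<⇒≤pred (toℕ<n t))))

module _ (D : Digraph) {n k : ℕ} (h : E D → S (suc n) k) where

  ⊗-base : V (⊗-prod D (suc n) k h) ⊎ E (⊗-prod D (suc n) k h) → V D ⊎ E D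
  ⊗-base (inj₁ (a , _)) = inj₁ a
  ⊗-base (inj₂ (e , _)) = inj₂ e

  ⊗-level : V (⊗-prod D (suc n) k h) ⊎ E (⊗-prod D (suc n) k h) → ℕ
  ⊗-level (inj₁ (_ , i)) = vlab i
  ⊗-level (inj₂ (e , r)) = k + suc n ∸ arcSum (h e) r

  ⊗-fibreNumbering : FibreNumbering ⊗-base ⊗-level (suc n)
  ⊗-fibreNumbering = record { in-range = in-range ; injective = injective ; onto = onto }
    where
    in-range : ∀ x → 1 ≤ ⊗-level x × ⊗-level x ≤ suc n
    in-range (inj₁ (_ , i)) = m≤n+m 1 (toℕ i) , subst (_≤ suc n) (+-comm 1 (toℕ i)) (toℕ<n i)
    in-range (inj₂ (e , r)) with k≤σ , σ<k+p ← arcSum-bounds (h e) r =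
      m<n⇒0<n∸m σ<k+p , ≤-trans (∸-monoʳ-≤ (k + suc n) k≤σ) (≤-reflexive (m+n∸m≡n k (suc n)))

    injective : ∀ {x x′} → ⊗-base x ≡ ⊗-base x′ → ⊗-level x ≡ ⊗-level x′ → x ≡ x′
    injective {inj₁ (a , i)} {inj₁ (a , j)} refl eq =
      cong (inj₁ ∘ (a ,_)) (toℕ-injective (+-cancelʳ-≡ 1 (toℕ i) (toℕ j) eq))
    injective {inj₂ (e , r)} {inj₂ (e , r′)} refl eq =
      cong (inj₂ ∘ (e ,_)) (arcSum-injective (h e)
        (∸-cancelˡ-≡ (<⇒≤ (proj₂ (arcSum-bounds (h e) r))) (<⇒≤ (proj₂ (arcSum-bounds (h e) r′))) eq))

    k≤k+p∸j : ∀ {j} → j ≤ suc n → k ≤ k + suc n ∸ j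
    k≤k+p∸j {j} j≤p = subst (k ≤_) (sym (+-∸-assoc k j≤p)) (m≤m+n k (suc n ∸ j))

    onto : ∀ y j → 1 ≤ j → j ≤ suc n → ∃ λ x → ⊗-base x ≡ y × ⊗-level x ≡ j
    onto (inj₁ a) (suc j) _ j<p =
      inj₁ (a , fromℕ< j<p) , refl , trans (cong (_+ 1) (toℕ-fromℕ< j<p)) (+-comm j 1)
    onto (inj₂ e) j 1≤j j≤p
      with r , σ≡ ← sum-onto (h e) (k + suc n ∸ j) (k≤k+p∸j j≤p) (∸-monoʳ-≤ (k + suc n) 1≤j) =
      inj₂ (e , r) , refl , trans (cong (k + suc n ∸_) σ≡) (m∸[m∸n]≡n (≤-trans j≤p (m≤n+m (suc n) k)))

  induced≡blowUp : ∀ g x → induced D (suc n) k h g x ≡ suc n * (g (⊗-base x) ∸ 1) + ⊗-level x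
  induced≡blowUp g (inj₁ _) = refl
  induced≡blowUp g (inj₂ _) = refl

  ⊗-size : nV (⊗-prod D (suc n) k h) + nE (⊗-prod D (suc n) k h) ≡ suc n * (nV D + nE D)
  ⊗-size = trans (sym (*-distribʳ-+ (suc n) (nV D) (nE D))) (*-comm (nV D + nE D) (suc n))

  induced-edgeMagic : ∀ {g c} → IsEdgeMagicWithVal D g c →
    IsEdgeMagicWithVal (⊗-prod D (suc n) k h) (induced D (suc n) k h g) (suc n * (c ∸ 3) + (k + suc n))
  induced-edgeMagic {g} {c} (bijective , magic) =
    subst (IsBijectionOnto _ _) (sym ⊗-size) (IsBijectionOnto-blowUp ⊗-fibreNumbering bijective (induced≡blowUp g)) ,
    λ { (e , r) → arc-sum e r }
    where
    p : ℕ
    p = suc n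
    arc-sum : ∀ e r → p * (g (inj₁ (src D e)) ∸ 1) + vlab (proj₁ (arc (h e) r))
                      + (p * (g (inj₂ e) ∸ 1) + (k + p ∸ arcSum (h e) r))
                      + (p * (g (inj₁ (tgt D e)) ∸ 1) + vlab (proj₂ (arc (h e) r)))
                      ≡ p * (c ∸ 3) + (k + p)
    arc-sum e r = begin
      p * (x ∸ 1) + i + (p * (y ∸ 1) + (k + p ∸ (i + j))) + (p * (z ∸ 1) + j)
        ≡⟨ regroup p (x ∸ 1) (y ∸ 1) (z ∸ 1) i j (k + p ∸ (i + j)) ⟩
      p * ((x ∸ 1) + (y ∸ 1) + (z ∸ 1)) + (k + p ∸ (i + j) + (i + j))
        ≡⟨ cong₂ (λ u v → p * u + v) (pred-sum₃ (lower _) (lower _) (lower _))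
                                    (m∸n+n≡m (<⇒≤ (proj₂ (arcSum-bounds (h e) r)))) ⟩
      p * (x + y + z ∸ 3) + (k + p)
        ≡⟨ cong (λ u → p * (u ∸ 3) + (k + p)) (magic e) ⟩
      p * (c ∸ 3) + (k + p) ∎
      where
      open ≡-Reasoning
      x y z i j : ℕ
      x = g (inj₁ (src D e))
      y = g (inj₂ e)
      z = g (inj₁ (tgt D e))
      i = vlab (proj₁ (arc (h e) r))
      j = vlab (proj₂ (arc (h e) r))
      lower : ∀ x → 1 ≤ g x
      lower = proj₁ ∘ proj₁ bijective
      regroup : ∀ p a b d i j w → p * a + i + (p * b + w) + (p * d + j) ≡ p * (a + b + d) + (w + (i + j))
      regroup = solve-∀

[p+3]/2+[p+3]/2≡p+3 : ∀ p → p % 2 ≡ 1 → (p + 3) / 2 + (p + 3) / 2 ≡ p + 3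
[p+3]/2+[p+3]/2≡p+3 p p-odd = begin
  (p + 3) / 2 + (p + 3) / 2  ≡⟨ cong (λ t → t + t) (trans (cong (_/ 2) p+3≡) (m*n/n≡m (p / 2 + 2) 2)) ⟩
  (p / 2 + 2) + (p / 2 + 2)  ≡⟨ double (p / 2 + 2) ⟩
  (p / 2 + 2) * 2            ≡⟨ p+3≡ ⟨
  p + 3                      ∎
  where
  open ≡-Reasoning
  p+3≡ : p + 3 ≡ (p / 2 + 2) * 2
  p+3≡ = begin
    p + 3                  ≡⟨ cong (_+ 3) (trans (m≡m%n+[m/n]*n p 2) (cong (_+ p / 2 * 2) p-odd)) ⟩
    1 + p / 2 * 2 + 3      ≡⟨ regroup (p / 2) ⟩
    (p / 2 + 2) * 2        ∎
    where
    regroup : ∀ q → 1 + q * 2 + 3 ≡ (q + 2) * 2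
    regroup = solve-∀
  double : ∀ t → t + t ≡ t * 2
  double = solve-∀

-- For k = (p + 3)/2 the valence p(c − 3) + k + p of an induced labeling commutes with complementation.
valences-agree : ∀ {p k N m c} → k + k ≡ p + 3 → m ≡ p * N → 3 ≤ c → c ≤ 3 * N →
  p * (3 * (N + 1) ∸ c ∸ 3) + (k + p) ≡ 3 * (m + 1) ∸ (p * (c ∸ 3) + (k + p))
valences-agree {p} {k} {N} {m} {c} k+k≡ m≡pN 3≤c c≤3N = begin
  p * (3 * (N + 1) ∸ c ∸ 3) + (k + p)                      ≡⟨ cong (λ t → p * t + (k + p)) reflected ⟩
  p * b + (k + p)                                          ≡⟨ m+n∸m≡n (p * a + (k + p)) _ ⟨
  p * a + (k + p) + (p * b + (k + p)) ∸ (p * a + (k + p))  ≡⟨ cong (_∸ (p * a + (k + p))) total ⟩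
  3 * (m + 1) ∸ (p * a + (k + p))                          ∎
  where
  open ≡-Reasoning
  a b : ℕ
  a = c ∸ 3
  b = 3 * N ∸ c
  reflected : 3 * (N + 1) ∸ c ∸ 3 ≡ b
  reflected = begin
    3 * (N + 1) ∸ c ∸ 3    ≡⟨ ∸-+-assoc (3 * (N + 1)) c 3 ⟩
    3 * (N + 1) ∸ (c + 3)  ≡⟨ cong₂ _∸_ (*-distribˡ-+ 3 N 1) (+-comm c 3) ⟩
    (3 * N + 3) ∸ (3 + c)  ≡⟨ cong (_∸ (3 + c)) (+-comm (3 * N) 3) ⟩
    (3 + 3 * N) ∸ (3 + c)  ≡⟨ [m+n]∸[m+o]≡n∸o 3 (3 * N) c ⟩
    b                      ∎
  3+a+b≡3N : 3 + a + b ≡ 3 * N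
  3+a+b≡3N = trans (cong (_+ b) (m+[n∸m]≡n 3≤c)) (m+[n∸m]≡n c≤3N)
  total : p * a + (k + p) + (p * b + (k + p)) ≡ 3 * (m + 1)
  total = begin
    p * a + (k + p) + (p * b + (k + p))  ≡⟨ regroup p k a b ⟩
    p * (a + b) + p + p + (k + k)       ≡⟨ cong (p * (a + b) + p + p +_) k+k≡ ⟩
    p * (a + b) + p + p + (p + 3)       ≡⟨ collect p a b ⟩
    p * (3 + a + b) + 3                 ≡⟨ cong (λ t → p * t + 3) 3+a+b≡3N ⟩
    p * (3 * N) + 3                     ≡⟨ spread p N ⟩
    3 * (p * N + 1)                     ≡⟨ cong (λ t → 3 * (t + 1)) m≡pN ⟨
    3 * (m + 1)                         ∎
    where
    regroup : ∀ p k a b → p * a + (k + p) + (p * b + (k + p)) ≡ p * (a + b) + p + p + (k + k)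
    regroup = solve-∀
    collect : ∀ p a b → p * (a + b) + p + p + (p + 3) ≡ p * (3 + a + b) + 3
    collect = solve-∀
    spread : ∀ p N → p * (3 * N) + 3 ≡ 3 * (p * N + 1)
    spread = solve-∀

corollary2p3 : (D : Digraph) → NoMultipleArcs D →
    (f : Labeling D) → IsEdgeMagic D f →
    (p : ℕ) → p % 2 ≡ 1 →
    (h : E D → S p ((p + 3) / 2)) →
    Σ (E D → S p ((p + 3) / 2)) (λ h̄ → Σ ℕ (λ c →
      IsEdgeMagicWithVal (⊗-prod D p ((p + 3) / 2) h)
        (complement (⊗-prod D p ((p + 3) / 2) h) (induced D p ((p + 3) / 2) h f)) c
      × IsEdgeMagicWithVal (⊗-prod D p ((p + 3) / 2) h̄)
        (induced D p ((p + 3) / 2) h̄ (complement D f)) c))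
corollary2p3 D _ f _ zero () h
corollary2p3 D _ f (c , magic) (suc n) p-odd h =
  h , _ ,
  complement-edgeMagic (⊗-prod D (suc n) _ h) (induced-edgeMagic D h magic) ,
  edgeMagic-cong-valence (⊗-prod D (suc n) _ h)
    (λ { (e , _) → uncurry (valences-agree k+k≡p+3 (⊗-size D h)) (edgeMagic-valence-bounds D magic e) })
    (induced-edgeMagic D h (complement-edgeMagic D magic))
  where
  k+k≡p+3 : (suc n + 3) / 2 + (suc n + 3) / 2 ≡ suc n + 3
  k+k≡p+3 = [p+3]/2+[p+3]/2≡p+3 (suc n) p-odd
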